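{- (a) For all integers $a,b$ with $1\le a<b$ there exists an integer $n$ with $0\le n\le \frac{5}{3}b$ such that $\mathbf{t}[n]\notin\{\mathbf{t}[n+a],\mathbf{t}[n+b]\}$. (b) The bound in (a) is optimal in the following sense: for every $m$ there exist integers $a,b$ with $1\le a<b$ and $b>m$ such that $\mathbf{t}[i]\in\{\mathbf{t}[i+a],\mathbf{t}[i+b]\}$ for every integer $i$ with $0\le i<\frac{5}{3}b$; hence if the bound $\frac53 b$ is reduced, there are infinitely many counterexamples.
   Context: The Thue–Morse sequence $\mathbf{t}=01101001\cdots$ is the infinite fixed point, starting with $0$, of the morphism $0\mapsto01$, $1\mapsto10$; it is indexed from $0$. -}

module Defs where

open import Data.Nat using (ℕ; zero; suc; _/_; _%_)
open import Data.Bool using (Bool; true; false; not)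

-- Thue–Morse sequence t = 0110 1001 ..., encoded with false = 0, true = 1.
-- It is the fixed point of 0 ↦ 01, 1 ↦ 10 starting with 0, characterised by
--   t 0 = 0,  t (2k) = t k,  t (2k+1) = 1 - t k.
-- We compute it with a fuel argument (fuel n suffices for index n).
tmAux : ℕ → ℕ → Bool
tmAux zero    _ = false
tmAux (suc f) zero = false
tmAux (suc f) (suc n) with (suc n) % 2
... | zero  = tmAux f (suc n / 2)
... | suc _ = not (tmAux f (suc n / 2))

t : ℕ → Bool
t n = tmAux n n

private
  open import Data.List using (List; map; upTo; _∷_; [])
  open import Relation.Binary.PropositionalEquality using (_≡_; refl)
  test : map t (upTo 16) ≡ map (λ c → c) (false ∷ true ∷ true ∷ false ∷ true ∷ false ∷ false ∷ true ∷ true ∷ false ∷ false ∷ true ∷ false ∷ true ∷ true ∷ false ∷ [])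
  test = refl

{-# OPTIONS --safe #-}
module Submission where

-- Write n = r + 2m, a = α + 2x, b = β + 2y with bits r, α, β. Since t (r + 2m) = t m xor r, the
-- bit t n xor t (n + a) is t m xor t (m + x + k) up to known bits, k being the carry out of the
-- lowest digit of n + a, and 3n + 3 ≤ 5b + σ follows from 3m + 3 ≤ 5y + σ′ for an explicit σ′.
-- So a requirement on n (two carries, two prescribed difference bits, a slack) becomes a
-- requirement of the same kind on m, and the slack stays bounded. A finite certificate of
-- disjunctions of such requirements, closed under this halving of a and b and met outright when
-- b = 0, is checked by evaluation; its root is the requirement of part (a), and induction on b
-- concludes. For part (b), a = 2, b = 3 is checked directly, and t (r + 2i) = t i xor r doubles
-- a, b and the range at once.

open import Defs
open import Algebra.Bundles using (CommutativeRing)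
open import Data.Bool using (Bool; true; false; not; _∧_; _∨_; _xor_)
import Data.Bool as Bool
open import Data.Bool.Properties using (xor-assoc; xor-comm; xor-same; xor-identityʳ; xor-∧-commutativeRing)
open import Algebra.Properties.CommutativeSemigroup (CommutativeRing.+-commutativeSemigroup xor-∧-commutativeRing) using (interchange)
open import Data.Empty using (⊥-elim)
open import Data.Fin using (Fin; #_)
import Data.Fin.Properties as Fin
open import Data.List using (List; []; _∷_)
open import Data.List.Relation.Unary.All as All using (All)
open import Data.List.Relation.Unary.Any as Any using (Any; here)
open import Data.Nat using (ℕ; zero; suc; _+_; _*_; _∸_; _^_; _≡ᵇ_; _≤_; _<_; ⌊_/2⌋; z≤n; s≤s; z<s)
open import Data.Nat.DivMod using (_/_; _%_; m/n*n≤m; m/n<m; m*n/n≡m; +-distrib-/; [m+kn]%n≡m%n; m*n%n≡0; m%n<n)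
open import Data.Nat.Induction using (<-rec)
open import Data.Nat.Properties
open import Data.Nat.Tactic.RingSolver using (solve-∀)
open import Data.Product using (_×_; _,_; proj₁; proj₂; ∃-syntax)
open import Data.Sum using (_⊎_; inj₁; inj₂)
import Data.Sum as Sum
open import Data.Vec using (Vec; lookup; _∷_; [])
open import Function using (_∘_)
open import Relation.Binary.PropositionalEquality using (_≡_; _≢_; refl; sym; trans; cong; cong₂; subst; subst₂; module ≡-Reasoning)
open import Relation.Nullary using (Dec)
open import Relation.Nullary.Decidable using (toWitness; map′; _×-dec_; _⊎-dec_)

-- Binary expansions and the Thue–Morse recursion

toℕ : Bool → ℕ
toℕ false = 0
toℕ true  = 1

infixr 8 _∷ᵇ_

_∷ᵇ_ : Bool → ℕ → ℕ
b ∷ᵇ n = toℕ b + n * 2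

lowBit : ℕ → Bool
lowBit zero          = false
lowBit (suc zero)    = true
lowBit (suc (suc n)) = lowBit n

lowBit∷ᵇ⌊n/2⌋≡n : ∀ n → lowBit n ∷ᵇ ⌊ n /2⌋ ≡ n
lowBit∷ᵇ⌊n/2⌋≡n zero          = refl
lowBit∷ᵇ⌊n/2⌋≡n (suc zero)    = refl
lowBit∷ᵇ⌊n/2⌋≡n (suc (suc n)) =
  trans (trans (+-suc _ _) (cong suc (+-suc _ _))) (cong (suc ∘ suc) (lowBit∷ᵇ⌊n/2⌋≡n n))

module _ {I : Set} (next : I → Bool → Bool → I) (P : I → ℕ → ℕ → Set)
         (base : ∀ i x → P i x 0)
         (step : ∀ i α β x y → P (next i α β) x y → P i (α ∷ᵇ x) (β ∷ᵇ y)) where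

  ∷ᵇ-induction : ∀ y i x → P i x y
  ∷ᵇ-induction = <-rec (λ y → ∀ i x → P i x y) go
    where
    go : ∀ y → (∀ {y′} → y′ < y → ∀ i x → P i x y′) → ∀ i x → P i x y
    go zero    _   i x = base i x
    go (suc y) rec i x =
      subst₂ (P i) (lowBit∷ᵇ⌊n/2⌋≡n x) (lowBit∷ᵇ⌊n/2⌋≡n (suc y))
        (step i _ _ _ _ (rec (⌊n/2⌋<n y) (next i (lowBit x) (lowBit (suc y))) ⌊ x /2⌋))

[1+n]/2≤n : ∀ n → suc n / 2 ≤ n
[1+n]/2≤n n = ≤-pred (m/n<m (suc n) 2 (s≤s (s≤s z≤n)))

tmAux-fuel : ∀ {f g n} → n ≤ f → n ≤ g → tmAux f n ≡ tmAux g n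
tmAux-fuel {zero}  {zero}  {zero}  _       _       = refl
tmAux-fuel {zero}  {suc g} {zero}  _       _       = refl
tmAux-fuel {suc f} {zero}  {zero}  _       _       = refl
tmAux-fuel {suc f} {suc g} {zero}  _       _       = refl
tmAux-fuel {suc f} {suc g} {suc n} (s≤s p) (s≤s q) with suc n % 2
... | zero  = tmAux-fuel (≤-trans ([1+n]/2≤n n) p) (≤-trans ([1+n]/2≤n n) q)
... | suc _ = cong not (tmAux-fuel (≤-trans ([1+n]/2≤n n) p) (≤-trans ([1+n]/2≤n n) q))

t-half : ∀ n → t n ≡ t (n / 2) xor (n % 2 ≡ᵇ 1)
t-half zero = refl
t-half (suc n) with suc n % 2 in eq
... | zero        = trans (tmAux-fuel ([1+n]/2≤n n) ≤-refl) (sym (xor-identityʳ _))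
... | suc zero    = trans (cong not (tmAux-fuel ([1+n]/2≤n n) ≤-refl)) (xor-comm true _)
... | suc (suc _) = ⊥-elim (<-irrefl refl (≤-trans (subst (_< 2) eq (m%n<n (suc n) 2)) (s≤s (s≤s z≤n))))

∷ᵇ/2 : ∀ b u → (b ∷ᵇ u) / 2 ≡ u
∷ᵇ/2 false u = m*n/n≡m u 2
∷ᵇ/2 true  u = trans (+-distrib-/ 1 (u * 2) 1%2+[u*2]%2<2) (m*n/n≡m u 2)
  where 1%2+[u*2]%2<2 : 1 % 2 + (u * 2) % 2 < 2
        1%2+[u*2]%2<2 = subst (λ r → 1 + r < 2) (sym (m*n%n≡0 u 2)) ≤-refl

∷ᵇ%2 : ∀ b u → ((b ∷ᵇ u) % 2 ≡ᵇ 1) ≡ b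
∷ᵇ%2 b u = trans (cong (_≡ᵇ 1) ([m+kn]%n≡m%n (toℕ b) u 2)) (lemma b)
  where lemma : ∀ b → (toℕ b % 2 ≡ᵇ 1) ≡ b
        lemma false = refl
        lemma true  = refl

t-∷ᵇ : ∀ b u → t (b ∷ᵇ u) ≡ t u xor b
t-∷ᵇ b u = trans (t-half (b ∷ᵇ u)) (cong₂ _xor_ (cong t (∷ᵇ/2 b u)) (∷ᵇ%2 b u))

majority : Bool → Bool → Bool → Bool
majority p q r = (p ∧ q) ∨ (p ∧ r) ∨ (q ∧ r)

full-adder : ∀ p q r → toℕ p + toℕ q + toℕ r ≡ toℕ (p xor q xor r) + toℕ (majority p q r) * 2
full-adder false false false = refl
full-adder false false true  = refl
full-adder false true  false = refl
full-adder false true  true  = refl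
full-adder true  false false = refl
full-adder true  false true  = refl
full-adder true  true  false = refl
full-adder true  true  true  = refl

∷ᵇ-+-carry : ∀ p q c m x →
  p ∷ᵇ m + (q ∷ᵇ x + toℕ c) ≡ (p xor q xor c) ∷ᵇ (m + (x + toℕ (majority p q c)))
∷ᵇ-+-carry p q c m x = begin
  toℕ p + m * 2 + (toℕ q + x * 2 + toℕ c)        ≡⟨ regroup (toℕ p) (toℕ q) (toℕ c) m x ⟩
  toℕ p + toℕ q + toℕ c + (m + x) * 2            ≡⟨ cong (_+ (m + x) * 2) (full-adder p q c) ⟩
  toℕ (p xor q xor c) + toℕ k * 2 + (m + x) * 2  ≡⟨ regroup′ (toℕ (p xor q xor c)) (toℕ k) m x ⟩
  toℕ (p xor q xor c) + (m + (x + toℕ k)) * 2    ∎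
  where
  open ≡-Reasoning
  k = majority p q c
  regroup : ∀ p q c m x → p + m * 2 + (q + x * 2 + c) ≡ p + q + c + (m + x) * 2
  regroup = solve-∀
  regroup′ : ∀ s k m x → s + k * 2 + (m + x) * 2 ≡ s + (m + (x + k)) * 2
  regroup′ = solve-∀

Δ : ℕ → ℕ → Bool
Δ a n = t n xor t (n + a)

xor-cancelˡ : ∀ r s → r xor (r xor s) ≡ s
xor-cancelˡ r s = trans (sym (xor-assoc r r s)) (cong (_xor s) (xor-same r))

xor-cancelʳ : ∀ d s → (d xor s) xor s ≡ d
xor-cancelʳ d s = trans (xor-assoc d s s) (trans (cong (d xor_) (xor-same s)) (xor-identityʳ d))

Δ-∷ᵇ : ∀ q c x r m → Δ (q ∷ᵇ x + toℕ c) (r ∷ᵇ m) ≡ Δ (x + toℕ (majority r q c)) m xor (q xor c)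
Δ-∷ᵇ q c x r m = begin
  t (r ∷ᵇ m) xor t (r ∷ᵇ m + (q ∷ᵇ x + toℕ c))     ≡⟨ cong (λ n → t (r ∷ᵇ m) xor t n) (∷ᵇ-+-carry r q c m x) ⟩
  t (r ∷ᵇ m) xor t ((r xor q xor c) ∷ᵇ m′)        ≡⟨ cong₂ _xor_ (t-∷ᵇ r m) (t-∷ᵇ (r xor q xor c) m′) ⟩
  (t m xor r) xor (t m′ xor (r xor q xor c))      ≡⟨ interchange (t m) r (t m′) (r xor q xor c) ⟩
  (t m xor t m′) xor (r xor (r xor q xor c))      ≡⟨ cong (Δ (x + toℕ (majority r q c)) m xor_) (xor-cancelˡ r (q xor c)) ⟩
  Δ (x + toℕ (majority r q c)) m xor (q xor c)    ∎
  where
  open ≡-Reasoning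
  m′ = m + (x + toℕ (majority r q c))

-- Requirements on a position and how they halve

record State : Set where
  constructor state
  field
    carryᵃ carryᵇ : Bool
    diffᵃ diffᵇ   : Bool
    slack         : ℕ

open State

-- The offset 3 keeps slacks natural: the requirement 3n ≤ 5b of part (a) has slack 3.
RealisedAt : ℕ → ℕ → State → ℕ → Set
RealisedAt a b q n =
  Δ (a + toℕ (carryᵃ q)) n ≡ diffᵃ q × Δ (b + toℕ (carryᵇ q)) n ≡ diffᵇ q × 3 * n + 3 ≤ 5 * b + slack q

realisedAt? : ∀ a b q n → Dec (RealisedAt a b q n)
realisedAt? a b q n =
  Δ (a + toℕ (carryᵃ q)) n Bool.≟ diffᵃ q ×-dec Δ (b + toℕ (carryᵇ q)) n Bool.≟ diffᵇ q
    ×-dec 3 * n + 3 ≤? 5 * b + slack q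

Realised : ℕ → ℕ → State → Set
Realised a b q = ∃[ n ] RealisedAt a b q n

halveSlack : ℕ → Bool → Bool → ℕ
halveSlack σ β r = (σ + 3 + 5 * toℕ β ∸ 3 * toℕ r) / 2

slack-∷ᵇ : ∀ σ β r m y → 3 * m + 3 ≤ 5 * y + halveSlack σ β r →
           3 * (r ∷ᵇ m) + 3 ≤ 5 * (β ∷ᵇ y) + σ
slack-∷ᵇ σ β r m y h = +-cancelʳ-≤ 3 _ _ (begin
  3 * (r ∷ᵇ m) + 3 + 3             ≡⟨ lhs (toℕ r) m ⟩
  (3 * m + 3) * 2 + 3 * toℕ r      ≤⟨ +-monoˡ-≤ (3 * toℕ r) (*-monoˡ-≤ 2 h) ⟩
  (5 * y + K / 2) * 2 + 3 * toℕ r  ≡⟨ cong (_+ 3 * toℕ r) (*-distribʳ-+ 2 (5 * y) (K / 2)) ⟩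
  5 * y * 2 + K / 2 * 2 + 3 * toℕ r ≤⟨ +-monoˡ-≤ (3 * toℕ r) (+-monoʳ-≤ (5 * y * 2) (m/n*n≤m K 2)) ⟩
  5 * y * 2 + K + 3 * toℕ r        ≡⟨ +-assoc (5 * y * 2) K (3 * toℕ r) ⟩
  5 * y * 2 + (K + 3 * toℕ r)      ≡⟨ cong (5 * y * 2 +_) (m∸n+n≡m 3r≤) ⟩
  5 * y * 2 + (σ + 3 + 5 * toℕ β)  ≡⟨ rhs σ (toℕ β) y ⟩
  5 * (β ∷ᵇ y) + σ + 3             ∎)
  where
  open ≤-Reasoning
  K = σ + 3 + 5 * toℕ β ∸ 3 * toℕ r
  3r≤3 : ∀ r → 3 * toℕ r ≤ 3
  3r≤3 false = z≤n
  3r≤3 true  = ≤-refl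
  3r≤ : 3 * toℕ r ≤ σ + 3 + 5 * toℕ β
  3r≤ = ≤-trans (3r≤3 r) (≤-trans (m≤n+m 3 σ) (m≤m+n (σ + 3) (5 * toℕ β)))
  lhs : ∀ r m → 3 * (r + m * 2) + 3 + 3 ≡ (3 * m + 3) * 2 + 3 * r
  lhs = solve-∀
  rhs : ∀ σ b y → 5 * y * 2 + (σ + 3 + 5 * b) ≡ 5 * (b + y * 2) + σ + 3
  rhs = solve-∀

pull : State → Bool → Bool → Bool → State
pull (state cᵃ cᵇ dᵃ dᵇ σ) α β r =
  state (majority r α cᵃ) (majority r β cᵇ) (dᵃ xor α xor cᵃ) (dᵇ xor β xor cᵇ) (halveSlack σ β r)

pull-realised : ∀ q α β r x y → Realised x y (pull q α β r) → Realised (α ∷ᵇ x) (β ∷ᵇ y) q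
pull-realised (state cᵃ cᵇ dᵃ dᵇ σ) α β r x y (m , Δᵃ , Δᵇ , bound) =
  r ∷ᵇ m ,
  trans (Δ-∷ᵇ α cᵃ x r m) (trans (cong (_xor (α xor cᵃ)) Δᵃ) (xor-cancelʳ dᵃ (α xor cᵃ))) ,
  trans (Δ-∷ᵇ β cᵇ y r m) (trans (cong (_xor (β xor cᵇ)) Δᵇ) (xor-cancelʳ dᵇ (β xor cᵇ))) ,
  slack-∷ᵇ σ β r m y bound

halve-≤ : ∀ {x y} → x * 2 ≤ 1 + y * 2 → x + 0 ≤ y
halve-≤ {x} {y} h = subst (_≤ y) (sym (+-identityʳ x)) (≤-pred (*-cancelʳ-< 2 x (suc y) (s≤s h)))

halve-< : ∀ {x y} → 1 + x * 2 ≤ y * 2 → x + 1 ≤ y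
halve-< {x} {y} h = subst (_≤ y) (+-comm 1 x) (*-cancelʳ-< 2 x y h)

exceeds : Bool → Bool → Bool → Bool
exceeds α c β = (α ∧ c) ∨ ((α ∨ c) ∧ not β)

∷ᵇ-+-≤-∷ᵇ : ∀ α c β x y → α ∷ᵇ x + toℕ c ≤ β ∷ᵇ y → x + toℕ (exceeds α c β) ≤ y
∷ᵇ-+-≤-∷ᵇ false false false x y h = halve-≤ (m≤n⇒m≤1+n (≤-trans (m≤m+n (x * 2) 0) h))
∷ᵇ-+-≤-∷ᵇ false false true  x y h = halve-≤ (≤-trans (m≤m+n (x * 2) 0) h)
∷ᵇ-+-≤-∷ᵇ false true  false x y h = halve-< (subst (_≤ y * 2) (+-comm (x * 2) 1) h)
∷ᵇ-+-≤-∷ᵇ false true  true  x y h = halve-≤ (≤-trans (m≤m+n (x * 2) 1) h)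
∷ᵇ-+-≤-∷ᵇ true  false false x y h = halve-< (≤-trans (s≤s (m≤m+n (x * 2) 0)) h)
∷ᵇ-+-≤-∷ᵇ true  false true  x y h = halve-≤ (m≤n⇒m≤1+n (≤-trans (m≤m+n (x * 2) 0) (≤-pred h)))
∷ᵇ-+-≤-∷ᵇ true  true  false x y h = halve-< (≤-trans (s≤s (m≤m+n (x * 2) 1)) h)
∷ᵇ-+-≤-∷ᵇ true  true  true  x y h = halve-< (subst (_≤ y * 2) (+-comm (x * 2) 1) (≤-pred h))

1≤∷ᵇ-+ : ∀ α z x → 1 ≤ α ∷ᵇ x + toℕ z → 1 ≤ x + toℕ (z ∨ α)
1≤∷ᵇ-+ α     true  x h = subst (1 ≤_) (+-comm 1 x) (s≤s z≤n)
1≤∷ᵇ-+ true  false x h = subst (1 ≤_) (+-comm 1 x) (s≤s z≤n)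
1≤∷ᵇ-+ false false zero    ()
1≤∷ᵇ-+ false false (suc x) h = s≤s z≤n

-- If a = A + 2ᵏ x and b = B + 2ᵏ y with A, B < 2ᵏ, then a < b iff x + c ≤ y for c = [B < A + 1],
-- and 1 ≤ a iff 1 ≤ x + z for z = [A ≠ 0].
Guard : Bool → Bool → ℕ → ℕ → Set
Guard c z x y = x + toℕ c ≤ y × 1 ≤ x + toℕ z

guard-∷ᵇ : ∀ c z α β x y → Guard c z (α ∷ᵇ x) (β ∷ᵇ y) → Guard (exceeds α c β) (z ∨ α) x y
guard-∷ᵇ c z α β x y (below , positive) = ∷ᵇ-+-≤-∷ᵇ α c β x y below , 1≤∷ᵇ-+ α z x positive

-- The certificate

_≟ˢ_ : (p q : State) → Dec (p ≡ q)
state a b c d s ≟ˢ state a′ b′ c′ d′ s′ =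
  map′ (λ { (refl , refl , refl , refl , refl) → refl }) (λ { refl → refl , refl , refl , refl , refl })
       (a Bool.≟ a′ ×-dec b Bool.≟ b′ ×-dec c Bool.≟ c′ ×-dec d Bool.≟ d′ ×-dec s ≟ s′)

PulledFrom : List State → Bool → Bool → State → Set
PulledFrom qs α β q′ = Any (λ q → pull q α β false ≡ q′ ⊎ pull q α β true ≡ q′) qs

pulledFrom? : ∀ qs α β q′ → Dec (PulledFrom qs α β q′)
pulledFrom? qs α β q′ = Any.any? (λ q → pull q α β false ≟ˢ q′ ⊎-dec pull q α β true ≟ˢ q′) qs

pulledFrom-realised : ∀ {qs α β q′ x y} → PulledFrom qs α β q′ → Realised x y q′ →
                      Any (Realised (α ∷ᵇ x) (β ∷ᵇ y)) qs
pulledFrom-realised {α = α} {β} {x = x} {y} pulled realised = Any.map lift pulled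
  where
  lift : ∀ {q} → pull q α β false ≡ _ ⊎ pull q α β true ≡ _ → Realised (α ∷ᵇ x) (β ∷ᵇ y) q
  lift {q} (inj₁ refl) = pull-realised q α β false x y realised
  lift {q} (inj₂ refl) = pull-realised q α β true  x y realised

size : ℕ
size = 377

record Node : Set where
  constructor node
  field
    states                      : List State
    carry nonzero               : Bool
    next₀₀ next₀₁ next₁₀ next₁₁ : Fin size

open Node

successor : Node → Bool → Bool → Fin size
successor n false false = next₀₀ n
successor n false true  = next₀₁ n
successor n true  false = next₁₀ n
successor n true  true  = next₁₁ n

NodeSound : Node → ℕ → ℕ → Set
NodeSound n x y = Guard (carry n) (nonzero n) x y → Any (Realised x y) (states n)

BaseValid : Node → Set
BaseValid n = carry n ≡ true ⊎ nonzero n ≡ false ⊎ Any (λ q → RealisedAt 0 0 q 0 ⊎ RealisedAt 0 0 q 1) (states n)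

baseValid? : ∀ n → Dec (BaseValid n)
baseValid? n = carry n Bool.≟ true ⊎-dec nonzero n Bool.≟ false
               ⊎-dec Any.any? (λ q → realisedAt? 0 0 q 0 ⊎-dec realisedAt? 0 0 q 1) (states n)

baseValid-sound : ∀ n x → BaseValid n → NodeSound n x 0
baseValid-sound n (suc x) _ (() , _)
baseValid-sound (node qs true  z _ _ _ _) zero _ (() , _)
baseValid-sound (node qs false false _ _ _ _) zero _ (_ , ())
baseValid-sound (node qs false true _ _ _ _) zero (inj₂ (inj₂ witnessed)) _ = Any.map witness witnessed
  where
  witness : ∀ {q} → RealisedAt 0 0 q 0 ⊎ RealisedAt 0 0 q 1 → Realised 0 0 q
  witness (inj₁ at0) = 0 , at0
  witness (inj₂ at1) = 1 , at1

StepValid : Node → Node → Bool → Bool → Set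
StepValid n m α β = carry m ≡ exceeds α (carry n) β × nonzero m ≡ (nonzero n ∨ α)
                    × All (PulledFrom (states n) α β) (states m)

stepValid? : ∀ n m α β → Dec (StepValid n m α β)
stepValid? n m α β = carry m Bool.≟ exceeds α (carry n) β ×-dec nonzero m Bool.≟ (nonzero n ∨ α)
                     ×-dec All.all? (pulledFrom? (states n) α β) (states m)

stepValid-sound : ∀ n m α β → StepValid n m α β →
                  ∀ x y → NodeSound m x y → NodeSound n (α ∷ᵇ x) (β ∷ᵇ y)
stepValid-sound n m α β (refl , refl , pulled) x y sound guard =
  All.lookupWith {R = λ _ → Any (Realised (α ∷ᵇ x) (β ∷ᵇ y)) (states n)} pulledFrom-realised pulled
    (sound (guard-∷ᵇ (carry n) (nonzero n) α β x y guard))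

∀-bits? : {P : Bool → Bool → Set} → (∀ α β → Dec (P α β)) → Dec (∀ α β → P α β)
∀-bits? P? =
  map′ (λ { (p₀₀ , p₀₁ , p₁₀ , p₁₁) → λ { false false → p₀₀ ; false true → p₀₁ ; true false → p₁₀ ; true true → p₁₁ } })
       (λ p → p false false , p false true , p true false , p true true)
       (P? false false ×-dec P? false true ×-dec P? true false ×-dec P? true true)

-- Generated by exploring the nodes reachable from node 0, the requirement of part (a).
certificate : Vec Node size
certificate =
  node (state false false true true 3 ∷ []) true false (# 0) (# 1) (# 2) (# 3) ∷
  node (state false true true false 4 ∷ []) false false (# 4) (# 5) (# 2) (# 6) ∷
  node (state false false false true 3 ∷ []) true true (# 2) (# 7) (# 8) (# 9) ∷
  node (state false false false false 5 ∷ state true true false false 4 ∷ []) true true (# 10) (# 11) (# 12) (# 13) ∷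
  node (state false false true true 3 ∷ []) false false (# 4) (# 1) (# 2) (# 14) ∷
  node (state false true true false 6 ∷ []) false false (# 15) (# 16) (# 17) (# 18) ∷
  node (state false true false false 6 ∷ state true true false false 4 ∷ []) false true (# 19) (# 20) (# 21) (# 22) ∷
  node (state false false false false 5 ∷ state false true false false 4 ∷ []) false true (# 23) (# 24) (# 10) (# 25) ∷
  node (state false false true true 3 ∷ state true false true true 1 ∷ []) true true (# 26) (# 27) (# 28) (# 29) ∷
  node (state true true true false 4 ∷ []) true true (# 2) (# 6) (# 30) (# 31) ∷
  node (state false false true true 3 ∷ state true true true true 2 ∷ []) true true (# 32) (# 33) (# 2) (# 34) ∷
  node (state false true false true 5 ∷ state true true true false 4 ∷ []) false true (# 35) (# 36) (# 37) (# 38) ∷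
  node (state true false true false 2 ∷ state true true false true 2 ∷ []) true true (# 39) (# 40) (# 41) (# 42) ∷
  node (state true true false false 6 ∷ state true true true true 5 ∷ []) true true (# 43) (# 44) (# 45) (# 46) ∷
  node (state false false false false 5 ∷ state true true false false 4 ∷ []) false true (# 47) (# 11) (# 12) (# 48) ∷
  node (state false false true true 4 ∷ []) false false (# 4) (# 1) (# 2) (# 49) ∷
  node (state false true true false 7 ∷ []) false false (# 50) (# 16) (# 51) (# 52) ∷
  node (state false false false true 4 ∷ []) true true (# 2) (# 53) (# 54) (# 9) ∷
  node (state false true false false 7 ∷ state true true false false 5 ∷ []) false true (# 55) (# 20) (# 21) (# 56) ∷
  node (state false false true true 3 ∷ state false true false true 3 ∷ []) false true (# 57) (# 58) (# 2) (# 59) ∷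
  node (state false true false false 7 ∷ state false true true false 6 ∷ []) false true (# 60) (# 61) (# 62) (# 18) ∷
  node (state true true false true 2 ∷ state true true true true 3 ∷ []) true true (# 63) (# 64) (# 65) (# 66) ∷
  node (state true true false false 6 ∷ state true true true false 5 ∷ []) false true (# 67) (# 68) (# 69) (# 70) ∷
  node (state false false false false 4 ∷ state false false false true 3 ∷ []) false true (# 71) (# 72) (# 73) (# 74) ∷
  node (state false true false false 6 ∷ state false true false true 5 ∷ []) false true (# 75) (# 76) (# 77) (# 78) ∷
  node (state true true true false 4 ∷ state true true true true 5 ∷ []) false true (# 35) (# 79) (# 37) (# 80) ∷
  node (state false false false true 2 ∷ state true false false true 0 ∷ []) true true (# 81) (# 82) (# 83) (# 84) ∷
  node (state false false false false 4 ∷ state true true false false 3 ∷ []) false true (# 85) (# 86) (# 87) (# 88) ∷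
  node (state true false false true 1 ∷ state true false true true 2 ∷ []) true true (# 89) (# 90) (# 91) (# 84) ∷
  node (state false false false false 5 ∷ state true true true false 3 ∷ []) true true (# 2) (# 92) (# 30) (# 93) ∷
  node (state true false true true 3 ∷ []) true true (# 2) (# 14) (# 30) (# 9) ∷
  node (state true true true false 6 ∷ []) true true (# 17) (# 18) (# 94) (# 95) ∷
  node (state false false false false 2 ∷ state false false true true 3 ∷ []) true true (# 32) (# 96) (# 2) (# 97) ∷
  node (state false true false true 5 ∷ state true true false true 3 ∷ []) false true (# 98) (# 99) (# 100) (# 101) ∷
  node (state true true false false 4 ∷ state true true true true 5 ∷ []) true true (# 102) (# 103) (# 104) (# 105) ∷
  node (state false false false false 4 ∷ state true true false true 2 ∷ []) false true (# 106) (# 107) (# 41) (# 108) ∷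
  node (state false true false true 6 ∷ state true true false false 4 ∷ []) false true (# 109) (# 110) (# 111) (# 48) ∷
  node (state true true true false 2 ∷ state true true true true 2 ∷ []) true true (# 112) (# 33) (# 113) (# 93) ∷
  node (state true true true false 6 ∷ state true true true true 5 ∷ []) false true (# 114) (# 79) (# 77) (# 115) ∷
  node (state true false false false 1 ∷ state true true true false 1 ∷ []) true true (# 116) (# 117) (# 118) (# 9) ∷
  node (state true true false true 3 ∷ state true true true true 3 ∷ []) false true (# 106) (# 119) (# 120) (# 101) ∷
  node (state true false false false 2 ∷ state true true false false 1 ∷ []) true true (# 121) (# 122) (# 123) (# 124) ∷
  node (state true true false true 5 ∷ state true true true true 3 ∷ []) true true (# 125) (# 126) (# 127) (# 128) ∷
  node (state true true false false 2 ∷ state true true true true 3 ∷ []) true true (# 129) (# 130) (# 131) (# 132) ∷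
  node (state false true false true 6 ∷ state true true true false 5 ∷ []) false true (# 35) (# 133) (# 134) (# 38) ∷
  node (state true true false true 3 ∷ state true true true false 2 ∷ []) true true (# 131) (# 135) (# 136) (# 93) ∷
  node (state true true false false 7 ∷ state true true true true 6 ∷ []) true true (# 137) (# 138) (# 139) (# 140) ∷
  node (state false false false false 4 ∷ state false false true true 3 ∷ []) false true (# 85) (# 141) (# 2) (# 59) ∷
  node (state true true false false 6 ∷ state true true true true 5 ∷ []) false true (# 142) (# 44) (# 45) (# 143) ∷
  node (state false false false false 6 ∷ state true true false false 4 ∷ []) false true (# 47) (# 11) (# 144) (# 48) ∷
  node (state false false true true 5 ∷ []) false false (# 15) (# 145) (# 17) (# 146) ∷
  node (state false false false true 5 ∷ []) true true (# 17) (# 147) (# 148) (# 93) ∷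
  node (state false true false false 7 ∷ state true true false false 6 ∷ []) false true (# 149) (# 61) (# 62) (# 70) ∷
  node (state false false false false 6 ∷ state false true false false 4 ∷ []) false true (# 23) (# 24) (# 10) (# 25) ∷
  node (state false false true true 3 ∷ state true false true true 2 ∷ []) true true (# 150) (# 151) (# 28) (# 29) ∷
  node (state false false true true 4 ∷ state false true false true 3 ∷ []) false true (# 57) (# 58) (# 2) (# 59) ∷
  node (state true true false false 6 ∷ state true true true false 6 ∷ []) false true (# 40) (# 18) (# 62) (# 152) ∷
  node (state false false false false 3 ∷ state false true false false 1 ∷ []) false true (# 153) (# 72) (# 121) (# 154) ∷
  node (state false true false true 5 ∷ state false true true false 4 ∷ []) false true (# 155) (# 156) (# 104) (# 157) ∷
  node (state true true false false 4 ∷ state true true true true 4 ∷ []) false true (# 158) (# 103) (# 104) (# 159) ∷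
  node (state false true false true 3 ∷ state false true true true 3 ∷ []) false true (# 160) (# 161) (# 63) (# 119) ∷
  node (state false true false false 7 ∷ state false true true false 7 ∷ []) false true (# 60) (# 61) (# 62) (# 56) ∷
  node (state true true false true 3 ∷ state true true true true 3 ∷ []) true true (# 63) (# 119) (# 120) (# 66) ∷
  node (state false false false false 3 ∷ state true true true false 1 ∷ []) true true (# 116) (# 162) (# 118) (# 9) ∷
  node (state true true false true 4 ∷ state true true true true 3 ∷ []) false true (# 163) (# 119) (# 120) (# 164) ∷
  node (state true false false false 2 ∷ state true true true false 1 ∷ []) true true (# 116) (# 117) (# 118) (# 9) ∷
  node (state true true false true 5 ∷ state true true true true 5 ∷ []) true true (# 165) (# 101) (# 166) (# 167) ∷
  node (state true true false true 2 ∷ state true true true true 3 ∷ []) false true (# 106) (# 64) (# 65) (# 101) ∷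
  node (state false true false false 6 ∷ state true true false false 5 ∷ []) false true (# 55) (# 20) (# 21) (# 22) ∷
  node (state true true false true 3 ∷ state true true true true 2 ∷ []) true true (# 168) (# 169) (# 120) (# 66) ∷
  node (state true true false false 7 ∷ state true true true false 6 ∷ []) false true (# 40) (# 18) (# 62) (# 152) ∷
  node (state false false false false 3 ∷ state false false false true 3 ∷ []) false true (# 71) (# 72) (# 170) (# 74) ∷
  node (state false true false false 4 ∷ state false true false true 4 ∷ []) false true (# 171) (# 172) (# 37) (# 74) ∷
  node (state true false true false 2 ∷ state true false true true 1 ∷ []) true true (# 173) (# 114) (# 174) (# 175) ∷
  node (state true true true false 4 ∷ state true true true true 4 ∷ []) false true (# 176) (# 177) (# 37) (# 80) ∷
  node (state false true false false 2 ∷ state false true false true 3 ∷ []) false true (# 57) (# 178) (# 113) (# 154) ∷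
  node (state false true false false 7 ∷ state false true false true 6 ∷ []) false true (# 179) (# 180) (# 175) (# 38) ∷
  node (state true true true false 2 ∷ state true true true true 3 ∷ []) true true (# 112) (# 181) (# 113) (# 93) ∷
  node (state true true true false 5 ∷ state true true true true 5 ∷ []) false true (# 35) (# 79) (# 37) (# 80) ∷
  node (state false true false true 6 ∷ state true true false true 5 ∷ []) false true (# 182) (# 183) (# 84) (# 164) ∷
  node (state true true true false 6 ∷ state true true true true 6 ∷ []) false true (# 114) (# 184) (# 175) (# 185) ∷
  node (state false false true true 1 ∷ state true false true true 0 ∷ []) true true (# 186) (# 187) (# 188) (# 165) ∷
  node (state false false false false 5 ∷ state true true true false 2 ∷ []) false true (# 189) (# 190) (# 136) (# 78) ∷
  node (state true false false true 1 ∷ state true false true true 1 ∷ []) true true (# 191) (# 192) (# 91) (# 84) ∷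
  node (state true false false false 4 ∷ state true true true false 3 ∷ []) true true (# 87) (# 59) (# 30) (# 93) ∷
  node (state false false false false 3 ∷ state false false true true 3 ∷ []) false true (# 85) (# 141) (# 2) (# 59) ∷
  node (state false true false true 4 ∷ state true true true false 4 ∷ []) false true (# 176) (# 36) (# 37) (# 193) ∷
  node (state true false true false 2 ∷ state true true false true 1 ∷ []) true true (# 194) (# 40) (# 195) (# 196) ∷
  node (state true true false false 5 ∷ state true true true true 4 ∷ []) false true (# 158) (# 44) (# 104) (# 159) ∷
  node (state true false false true 1 ∷ state true false true true 0 ∷ []) true true (# 191) (# 192) (# 197) (# 166) ∷
  node (state false false false false 5 ∷ state true true true false 3 ∷ []) false true (# 189) (# 92) (# 30) (# 78) ∷
  node (state true false false true 2 ∷ state true false true true 2 ∷ []) true true (# 83) (# 90) (# 91) (# 198) ∷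
  node (state false true false true 5 ∷ state true true false false 4 ∷ []) false true (# 199) (# 103) (# 104) (# 48) ∷
  node (state true true true false 5 ∷ []) true true (# 17) (# 68) (# 94) (# 31) ∷
  node (state true false true true 4 ∷ []) true true (# 2) (# 49) (# 30) (# 9) ∷
  node (state true true true false 7 ∷ []) true true (# 51) (# 52) (# 200) (# 95) ∷
  node (state false true false true 3 ∷ state false true true false 4 ∷ []) false true (# 201) (# 202) (# 203) (# 59) ∷
  node (state true true false false 4 ∷ state true true true true 3 ∷ []) true true (# 10) (# 11) (# 203) (# 13) ∷
  node (state false false false false 4 ∷ state true true true false 1 ∷ []) false true (# 204) (# 162) (# 118) (# 74) ∷
  node (state false true true true 5 ∷ state true true true true 4 ∷ []) false true (# 158) (# 177) (# 165) (# 205) ∷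
  node (state true false false false 3 ∷ state true true true false 2 ∷ []) true true (# 206) (# 135) (# 136) (# 93) ∷
  node (state true true false true 5 ∷ state true true true true 5 ∷ []) false true (# 182) (# 101) (# 166) (# 207) ∷
  node (state true true false false 2 ∷ state true true true true 2 ∷ []) true true (# 129) (# 130) (# 131) (# 132) ∷
  node (state false true false true 6 ∷ state true true true false 4 ∷ []) false true (# 35) (# 208) (# 134) (# 38) ∷
  node (state true true false true 2 ∷ state true true true false 2 ∷ []) true true (# 131) (# 117) (# 136) (# 93) ∷
  node (state true true false false 6 ∷ state true true true true 6 ∷ []) true true (# 137) (# 209) (# 139) (# 140) ∷
  node (state false false false false 3 ∷ state true true true false 1 ∷ []) false true (# 204) (# 162) (# 118) (# 74) ∷
  node (state false true true true 5 ∷ state true true true true 3 ∷ []) false true (# 210) (# 181) (# 211) (# 101) ∷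
  node (state true true false true 5 ∷ state true true true true 4 ∷ []) false true (# 163) (# 126) (# 166) (# 207) ∷
  node (state false false false false 4 ∷ state false true false false 3 ∷ []) false true (# 71) (# 212) (# 213) (# 74) ∷
  node (state false true false true 7 ∷ state true true true false 4 ∷ []) false true (# 214) (# 208) (# 134) (# 80) ∷
  node (state true true false true 2 ∷ state true true true false 3 ∷ []) true true (# 131) (# 215) (# 30) (# 93) ∷
  node (state true true false false 1 ∷ state true true false true 1 ∷ []) true true (# 216) (# 122) (# 195) (# 217) ∷
  node (state true true true false 1 ∷ state true true true true 1 ∷ []) true true (# 116) (# 218) (# 216) (# 9) ∷
  node (state false false false false 4 ∷ state true true false true 3 ∷ []) false true (# 106) (# 99) (# 219) (# 108) ∷
  node (state true true true false 7 ∷ state true true true true 6 ∷ []) false true (# 114) (# 220) (# 175) (# 185) ∷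
  node (state false false false true 2 ∷ state true true false true 0 ∷ []) true true (# 221) (# 222) (# 223) (# 224) ∷
  node (state true true false false 3 ∷ state true true true true 3 ∷ []) false true (# 85) (# 11) (# 131) (# 225) ∷
  node (state true false true true 2 ∷ state true true true true 0 ∷ []) true true (# 150) (# 226) (# 227) (# 228) ∷
  node (state true true false true 4 ∷ state true true true true 4 ∷ []) false true (# 163) (# 119) (# 100) (# 207) ∷
  node (state true false false false 3 ∷ state true true true false 1 ∷ []) true true (# 116) (# 135) (# 118) (# 9) ∷
  node (state false false true true 2 ∷ state true true true true 0 ∷ []) true true (# 229) (# 226) (# 221) (# 230) ∷
  node (state true true true false 3 ∷ state true true true true 3 ∷ []) false true (# 231) (# 181) (# 113) (# 78) ∷
  node (state true false false false 2 ∷ state true false false true 2 ∷ []) true true (# 170) (# 122) (# 123) (# 232) ∷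
  node (state true true false false 4 ∷ state true true false true 3 ∷ []) true true (# 233) (# 74) (# 234) (# 235) ∷
  node (state false false false false 3 ∷ state true true true false 2 ∷ []) true true (# 236) (# 162) (# 136) (# 93) ∷
  node (state true true false true 4 ∷ state true true true true 5 ∷ []) false true (# 182) (# 108) (# 100) (# 207) ∷
  node (state true false false false 4 ∷ state true true true false 1 ∷ []) true true (# 116) (# 135) (# 118) (# 9) ∷
  node (state true true false true 6 ∷ state true true true true 5 ∷ []) true true (# 237) (# 101) (# 166) (# 238) ∷
  node (state false false true true 2 ∷ state true true true true 1 ∷ []) true true (# 239) (# 218) (# 221) (# 230) ∷
  node (state false true false true 5 ∷ state true true true false 3 ∷ []) false true (# 189) (# 36) (# 240) (# 78) ∷
  node (state true true false true 1 ∷ state true true true false 1 ∷ []) true true (# 221) (# 117) (# 118) (# 9) ∷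
  node (state true true false false 5 ∷ state true true true true 5 ∷ []) true true (# 102) (# 44) (# 104) (# 105) ∷
  node (state false true false true 7 ∷ state true true false false 5 ∷ []) false true (# 241) (# 209) (# 111) (# 159) ∷
  node (state true true true false 3 ∷ state true true true true 2 ∷ []) true true (# 112) (# 33) (# 113) (# 93) ∷
  node (state true true false false 3 ∷ state true true true true 4 ∷ []) false true (# 158) (# 103) (# 242) (# 243) ∷
  node (state true false true true 2 ∷ state true true true true 1 ∷ []) true true (# 150) (# 218) (# 227) (# 228) ∷
  node (state true true false false 3 ∷ state true true true true 3 ∷ []) true true (# 213) (# 11) (# 131) (# 132) ∷
  node (state false true false true 7 ∷ state true true true false 6 ∷ []) false true (# 244) (# 133) (# 175) (# 115) ∷
  node (state true true false true 3 ∷ state true true true false 3 ∷ []) true true (# 131) (# 59) (# 30) (# 93) ∷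
  node (state true true false false 7 ∷ state true true true true 7 ∷ []) true true (# 137) (# 138) (# 139) (# 140) ∷
  node (state false true false true 4 ∷ state false true true false 4 ∷ []) false true (# 201) (# 156) (# 104) (# 59) ∷
  node (state true true false false 2 ∷ state true true true true 3 ∷ []) false true (# 245) (# 130) (# 131) (# 225) ∷
  node (state true true false false 7 ∷ state true true true true 6 ∷ []) false true (# 117) (# 138) (# 139) (# 246) ∷
  node (state true false true false 3 ∷ state true true false true 2 ∷ []) true true (# 39) (# 64) (# 41) (# 247) ∷
  node (state false true true false 5 ∷ []) false false (# 15) (# 5) (# 17) (# 68) ∷
  node (state false false false false 6 ∷ state true true false false 5 ∷ []) false true (# 248) (# 249) (# 144) (# 48) ∷
  node (state false false false false 6 ∷ state false true false false 5 ∷ []) false true (# 250) (# 24) (# 251) (# 78) ∷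
  node (state false false true true 4 ∷ state true false true true 2 ∷ []) true true (# 150) (# 151) (# 91) (# 252) ∷
  node (state false false true true 4 ∷ state true true true true 3 ∷ []) false true (# 85) (# 181) (# 2) (# 157) ∷
  node (state false false false true 2 ∷ state true false false true 1 ∷ []) true true (# 253) (# 90) (# 197) (# 84) ∷
  node (state false false false false 5 ∷ state true true false false 3 ∷ []) false true (# 47) (# 11) (# 87) (# 225) ∷
  node (state true true false false 7 ∷ state true true true false 7 ∷ []) false true (# 40) (# 56) (# 62) (# 152) ∷
  node (state false false false false 3 ∷ state false false false true 2 ∷ []) false true (# 153) (# 254) (# 170) (# 154) ∷
  node (state true true true false 3 ∷ state true true true true 4 ∷ []) false true (# 231) (# 177) (# 240) (# 255) ∷
  node (state false false false false 4 ∷ state false true true true 2 ∷ []) false true (# 160) (# 256) (# 257) (# 169) ∷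
  node (state false true false true 6 ∷ state false true true false 6 ∷ []) false true (# 258) (# 259) (# 139) (# 225) ∷
  node (state true true false false 4 ∷ state true true true true 5 ∷ []) false true (# 187) (# 103) (# 104) (# 159) ∷
  node (state false false false false 3 ∷ state true true false false 2 ∷ []) false true (# 245) (# 260) (# 206) (# 88) ∷
  node (state true true false false 6 ∷ state true true true true 6 ∷ []) false true (# 117) (# 209) (# 139) (# 246) ∷
  node (state false false false false 3 ∷ state false true true false 1 ∷ []) false true (# 261) (# 141) (# 116) (# 135) ∷
  node (state false true false true 5 ∷ state false true true true 5 ∷ []) false true (# 262) (# 263) (# 165) (# 101) ∷
  node (state false true false true 4 ∷ state true true false false 3 ∷ []) false true (# 171) (# 103) (# 242) (# 88) ∷
  node (state false false false false 3 ∷ state true true true false 2 ∷ []) false true (# 231) (# 162) (# 136) (# 264) ∷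
  node (state true true false true 6 ∷ state true true true true 5 ∷ []) false true (# 192) (# 101) (# 166) (# 265) ∷
  node (state false false false false 4 ∷ state true true true false 2 ∷ []) true true (# 236) (# 162) (# 136) (# 93) ∷
  node (state true false false false 4 ∷ state true true true false 2 ∷ []) true true (# 87) (# 135) (# 136) (# 93) ∷
  node (state true true false true 6 ∷ state true true true true 6 ∷ []) true true (# 237) (# 101) (# 84) (# 266) ∷
  node (state false false false false 2 ∷ state true true true false 1 ∷ []) true true (# 116) (# 267) (# 118) (# 9) ∷
  node (state true true false true 3 ∷ state true true true true 4 ∷ []) false true (# 106) (# 119) (# 100) (# 205) ∷
  node (state true false true false 1 ∷ state true false true true 1 ∷ []) true true (# 26) (# 114) (# 174) (# 175) ∷
  node (state false false false false 3 ∷ state false true false false 2 ∷ []) false true (# 153) (# 212) (# 129) (# 154) ∷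
  node (state false true false false 6 ∷ state false true false true 6 ∷ []) false true (# 179) (# 180) (# 175) (# 78) ∷
  node (state true false false false 1 ∷ state true false false true 0 ∷ []) true true (# 268) (# 269) (# 270) (# 271) ∷
  node (state true false true false 2 ∷ state true false true true 2 ∷ []) true true (# 272) (# 244) (# 174) (# 175) ∷
  node (state true true true false 3 ∷ state true true true true 3 ∷ []) true true (# 112) (# 181) (# 113) (# 93) ∷
  node (state false false false false 3 ∷ state true true false true 2 ∷ []) false true (# 106) (# 107) (# 41) (# 108) ∷
  node (state false true false true 6 ∷ state true true false true 4 ∷ []) false true (# 182) (# 273) (# 274) (# 164) ∷
  node (state false true false false 5 ∷ state false true false true 5 ∷ []) false true (# 199) (# 172) (# 37) (# 78) ∷
  node (state false true false false 3 ∷ state false true false true 3 ∷ []) false true (# 57) (# 178) (# 113) (# 74) ∷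
  node (state false true false false 7 ∷ state false true false true 7 ∷ []) false true (# 179) (# 180) (# 175) (# 80) ∷
  node (state false true false true 5 ∷ state true true false true 4 ∷ []) false true (# 182) (# 273) (# 100) (# 164) ∷
  node (state false false false false 4 ∷ state true true true false 2 ∷ []) false true (# 231) (# 162) (# 136) (# 264) ∷
  node (state false true true true 6 ∷ state true true true true 5 ∷ []) false true (# 187) (# 79) (# 165) (# 205) ∷
  node (state false true false true 7 ∷ state true true false true 5 ∷ []) false true (# 82) (# 183) (# 84) (# 207) ∷
  node (state true true true false 7 ∷ state true true true true 7 ∷ []) false true (# 244) (# 275) (# 175) (# 185) ∷
  node (state false false false true 1 ∷ state true false false true 0 ∷ []) true true (# 81) (# 182) (# 89) (# 84) ∷
  node (state false false false false 4 ∷ state true true false false 2 ∷ []) false true (# 245) (# 260) (# 87) (# 88) ∷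
  node (state true false false true 0 ∷ state true false true true 1 ∷ []) true true (# 191) (# 182) (# 28) (# 84) ∷
  node (state false false false false 4 ∷ state true true false true 1 ∷ []) false true (# 276) (# 277) (# 195) (# 119) ∷
  node (state false true false true 5 ∷ state true true false false 3 ∷ []) false true (# 199) (# 103) (# 242) (# 225) ∷
  node (state true false false true 0 ∷ state true false true true 0 ∷ []) true true (# 191) (# 182) (# 83) (# 166) ∷
  node (state false false false false 4 ∷ state true true true false 3 ∷ []) false true (# 231) (# 278) (# 30) (# 264) ∷
  node (state true true true false 6 ∷ state true true true true 4 ∷ []) false true (# 279) (# 177) (# 77) (# 115) ∷
  node (state true false false false 1 ∷ state true true true false 0 ∷ []) true true (# 280) (# 142) (# 281) (# 9) ∷
  node (state true false false false 2 ∷ state true true false false 0 ∷ []) true true (# 282) (# 269) (# 270) (# 124) ∷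
  node (state true true false true 4 ∷ state true true true true 3 ∷ []) true true (# 125) (# 119) (# 120) (# 128) ∷
  node (state true false false true 2 ∷ state true false true true 1 ∷ []) true true (# 188) (# 192) (# 91) (# 198) ∷
  node (state true false false false 5 ∷ state true true true false 3 ∷ []) true true (# 87) (# 157) (# 30) (# 93) ∷
  node (state false false false false 4 ∷ state false true false false 2 ∷ []) false true (# 153) (# 212) (# 129) (# 154) ∷
  node (state true false true true 5 ∷ []) true true (# 17) (# 146) (# 94) (# 93) ∷
  node (state false false false false 3 ∷ state false true true true 2 ∷ []) false true (# 160) (# 256) (# 257) (# 169) ∷
  node (state false true false true 5 ∷ state false true true false 6 ∷ []) false true (# 258) (# 283) (# 45) (# 225) ∷
  node (state true true false true 2 ∷ state true true true false 1 ∷ []) true true (# 284) (# 117) (# 118) (# 9) ∷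
  node (state false false false false 3 ∷ state true true false true 0 ∷ []) false true (# 276) (# 285) (# 223) (# 119) ∷
  node (state true true false true 5 ∷ state true true true true 6 ∷ []) false true (# 182) (# 101) (# 84) (# 286) ∷
  node (state true false true false 1 ∷ state true true false true 1 ∷ []) true true (# 287) (# 40) (# 195) (# 196) ∷
  node (state true true false true 6 ∷ state true true true true 6 ∷ []) false true (# 192) (# 101) (# 84) (# 288) ∷
  node (state false true false true 7 ∷ state true true false false 4 ∷ []) false true (# 241) (# 110) (# 111) (# 159) ∷
  node (state false true false true 7 ∷ state true true true false 5 ∷ []) false true (# 214) (# 133) (# 134) (# 80) ∷
  node (state false false false false 3 ∷ state false true true false 2 ∷ []) false true (# 289) (# 290) (# 206) (# 135) ∷
  node (state false false false false 4 ∷ state true true true false 1 ∷ []) true true (# 116) (# 162) (# 118) (# 9) ∷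
  node (state false true false false 5 ∷ state false true false true 4 ∷ []) false true (# 171) (# 172) (# 37) (# 264) ∷
  node (state false false true true 3 ∷ state true true true true 1 ∷ []) true true (# 32) (# 218) (# 2) (# 291) ∷
  node (state false false false false 5 ∷ state true true false true 2 ∷ []) false true (# 98) (# 107) (# 41) (# 101) ∷
  node (state true true false false 4 ∷ state true true true true 3 ∷ []) false true (# 85) (# 11) (# 203) (# 48) ∷
  node (state true true true false 0 ∷ state true true true true 0 ∷ []) true true (# 280) (# 226) (# 216) (# 9) ∷
  node (state true true false false 4 ∷ state true true false true 4 ∷ []) true true (# 37) (# 74) (# 292) (# 293) ∷
  node (state false true false true 4 ∷ state true true false true 3 ∷ []) false true (# 106) (# 99) (# 100) (# 108) ∷
  node (state true false false false 3 ∷ state true true false false 1 ∷ []) true true (# 121) (# 154) (# 294) (# 217) ∷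
  node (state true true false false 6 ∷ state true true false true 5 ∷ []) false true (# 269) (# 78) (# 271) (# 295) ∷
  node (state false false false true 2 ∷ state true true true false 0 ∷ []) true true (# 116) (# 296) (# 281) (# 9) ∷
  node (state false false false false 5 ∷ state false true true true 4 ∷ []) false true (# 262) (# 297) (# 298) (# 126) ∷
  node (state true false false false 1 ∷ state true true false false 0 ∷ []) true true (# 282) (# 269) (# 270) (# 124) ∷
  node (state true true false true 4 ∷ state true true true false 3 ∷ []) true true (# 242) (# 59) (# 299) (# 93) ∷
  node (state true true false false 5 ∷ state true true true true 5 ∷ []) false true (# 187) (# 44) (# 104) (# 159) ∷
  node (state false true false true 4 ∷ state true true false true 2 ∷ []) false true (# 106) (# 107) (# 300) (# 108) ∷
  node (state true false true true 2 ∷ state true true true false 0 ∷ []) true true (# 116) (# 151) (# 118) (# 9) ∷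
  node (state true true true false 3 ∷ state true true true true 4 ∷ []) true true (# 301) (# 177) (# 240) (# 93) ∷
  node (state false false false false 1 ∷ state false false true true 2 ∷ []) true true (# 239) (# 302) (# 303) (# 137) ∷
  node (state true true false false 3 ∷ state true true true true 4 ∷ []) true true (# 299) (# 103) (# 242) (# 304) ∷
  node (state false false false false 3 ∷ state true true false true 1 ∷ []) false true (# 276) (# 277) (# 195) (# 119) ∷
  node (state true true false false 3 ∷ state true true false true 3 ∷ []) true true (# 113) (# 74) (# 112) (# 305) ∷
  node (state true true true false 1 ∷ state true true true true 2 ∷ []) true true (# 116) (# 33) (# 306) (# 9) ∷
  node (state true true false false 1 ∷ state true true false true 2 ∷ []) true true (# 306) (# 122) (# 41) (# 307) ∷
  node (state true true false false 6 ∷ state true true false true 5 ∷ []) true true (# 77) (# 78) (# 271) (# 308) ∷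
  node (state false false false true 2 ∷ state true true false true 1 ∷ []) true true (# 221) (# 277) (# 195) (# 224) ∷
  node (state false false false false 4 ∷ state true true true false 3 ∷ []) true true (# 2) (# 278) (# 30) (# 93) ∷
  node (state true true false true 7 ∷ state true true true true 6 ∷ []) true true (# 237) (# 205) (# 198) (# 266) ∷
  node (state false false false false 2 ∷ state false false true true 2 ∷ []) true true (# 239) (# 302) (# 309) (# 137) ∷
  node (state true true true false 2 ∷ state true true true true 1 ∷ []) true true (# 310) (# 218) (# 311) (# 93) ∷
  node (state false false false false 5 ∷ state false true false false 3 ∷ []) false true (# 23) (# 178) (# 213) (# 25) ∷
  node (state true true false true 1 ∷ state true true true false 2 ∷ []) true true (# 312) (# 117) (# 136) (# 93) ∷
  node (state true true false false 5 ∷ state true true true true 6 ∷ []) false true (# 27) (# 209) (# 111) (# 313) ∷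
  node (state false false false false 5 ∷ state true true false true 3 ∷ []) false true (# 98) (# 99) (# 219) (# 101) ∷
  node (state false false false false 3 ∷ state false false true true 2 ∷ []) false true (# 245) (# 314) (# 309) (# 135) ∷
  node (state true true false false 7 ∷ state true true true true 7 ∷ []) false true (# 117) (# 138) (# 139) (# 246) ∷
  node (state true true false true 5 ∷ state true true true true 4 ∷ []) true true (# 125) (# 126) (# 166) (# 167) ∷
  node (state false false false false 4 ∷ state false false true true 4 ∷ []) false true (# 85) (# 141) (# 2) (# 59) ∷
  node (state false true false true 5 ∷ state true true true false 5 ∷ []) false true (# 35) (# 315) (# 37) (# 38) ∷
  node (state false false false false 4 ∷ state false false false true 4 ∷ []) false true (# 71) (# 72) (# 174) (# 74) ∷
  node (state false false true true 4 ∷ state true true true true 2 ∷ []) true true (# 32) (# 33) (# 2) (# 34) ∷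
  node (state false false false false 6 ∷ state true true true false 3 ∷ []) true true (# 2) (# 92) (# 30) (# 93) ∷
  node (state false false true true 2 ∷ state true false true true 0 ∷ []) true true (# 186) (# 187) (# 83) (# 316) ∷
  node (state false true false false 3 ∷ state false true false true 4 ∷ []) false true (# 171) (# 317) (# 240) (# 74) ∷
  node (state true true true false 5 ∷ state true true true true 6 ∷ []) false true (# 35) (# 184) (# 134) (# 318) ∷
  node (state false true false true 4 ∷ state false true true true 5 ∷ []) false true (# 210) (# 263) (# 165) (# 108) ∷
  node (state false false false false 2 ∷ state false false true false 3 ∷ []) true true (# 257) (# 319) (# 320) (# 196) ∷
  node (state false false false false 4 ∷ state false true true true 3 ∷ []) false true (# 160) (# 256) (# 321) (# 119) ∷
  node (state false true false true 7 ∷ state false true true false 7 ∷ []) false true (# 322) (# 259) (# 139) (# 159) ∷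
  node (state false true false true 4 ∷ state true true true false 3 ∷ []) false true (# 231) (# 36) (# 240) (# 264) ∷
  node (state false false false false 3 ∷ state false true true true 0 ∷ []) false true (# 323) (# 285) (# 324) (# 325) ∷
  node (state false false false false 4 ∷ state false true true false 2 ∷ []) false true (# 289) (# 290) (# 87) (# 135) ∷
  node (state false true false true 6 ∷ state false true true true 6 ∷ []) false true (# 326) (# 327) (# 237) (# 101) ∷
  node (state true true true false 5 ∷ state true true true true 4 ∷ []) false true (# 176) (# 177) (# 37) (# 80) ∷
  node (state true true false true 7 ∷ state true true true true 6 ∷ []) false true (# 192) (# 205) (# 198) (# 288) ∷
  node (state true true false true 7 ∷ state true true true true 7 ∷ []) true true (# 29) (# 207) (# 198) (# 266) ∷
  node (state false true false true 3 ∷ state true true false false 3 ∷ []) false true (# 57) (# 11) (# 131) (# 88) ∷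
  node (state true false true false 0 ∷ state true false true true 0 ∷ []) true true (# 186) (# 35) (# 170) (# 37) ∷
  node (state true true true false 2 ∷ state true true true true 3 ∷ []) false true (# 231) (# 181) (# 113) (# 78) ∷
  node (state true false false false 2 ∷ state true false false true 1 ∷ []) true true (# 328) (# 122) (# 123) (# 232) ∷
  node (state true true false false 2 ∷ state true true false true 3 ∷ []) true true (# 113) (# 154) (# 112) (# 305) ∷
  node (state true false false false 1 ∷ state true false false true 1 ∷ []) true true (# 268) (# 122) (# 123) (# 232) ∷
  node (state false true true true 6 ∷ state true true true true 4 ∷ []) false true (# 158) (# 177) (# 165) (# 205) ∷
  node (state true false false false 3 ∷ state true true true false 3 ∷ []) true true (# 206) (# 59) (# 30) (# 93) ∷
  node (state true true false false 6 ∷ state true true false true 6 ∷ []) false true (# 122) (# 78) (# 232) (# 329) ∷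
  node (state false false false false 3 ∷ state true true true false 0 ∷ []) false true (# 204) (# 330) (# 281) (# 74) ∷
  node (state false true true true 4 ∷ state true true true true 3 ∷ []) false true (# 210) (# 181) (# 63) (# 126) ∷
  node (state false true false true 4 ∷ state true true false false 4 ∷ []) false true (# 171) (# 103) (# 104) (# 331) ∷
  node (state false false false false 3 ∷ state true true false true 3 ∷ []) false true (# 106) (# 99) (# 219) (# 108) ∷
  node (state false false false true 1 ∷ state true true false true 0 ∷ []) true true (# 221) (# 332) (# 223) (# 224) ∷
  node (state true false true true 1 ∷ state true true true true 0 ∷ []) true true (# 26) (# 226) (# 227) (# 228) ∷
  node (state false false true true 1 ∷ state true true true true 0 ∷ []) true true (# 229) (# 226) (# 221) (# 230) ∷
  node (state false true false true 6 ∷ state false true true false 7 ∷ []) false true (# 258) (# 259) (# 139) (# 48) ∷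
  node (state false false false true 2 ∷ state true true true false 1 ∷ []) true true (# 116) (# 151) (# 118) (# 9) ∷
  node (state false true false true 4 ∷ state false true true true 4 ∷ []) false true (# 210) (# 263) (# 125) (# 119) ∷
  node (state true true false true 6 ∷ state true true true true 7 ∷ []) false true (# 90) (# 164) (# 84) (# 288) ∷
  node (state false false false false 2 ∷ state true true true false 0 ∷ []) true true (# 280) (# 333) (# 281) (# 9) ∷
  node (state true true false true 7 ∷ state true true true true 7 ∷ []) false true (# 90) (# 207) (# 198) (# 288) ∷
  node (state false false false false 3 ∷ state false true true true 1 ∷ []) false true (# 323) (# 285) (# 257) (# 169) ∷
  node (state false true false true 4 ∷ state false true true false 5 ∷ []) false true (# 201) (# 156) (# 104) (# 88) ∷
  node (state true true false false 4 ∷ state true true true true 4 ∷ []) true true (# 102) (# 103) (# 104) (# 105) ∷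
  node (state true true false false 2 ∷ state true true false true 2 ∷ []) true true (# 113) (# 122) (# 112) (# 305) ∷
  node (state true true false false 6 ∷ state true true false true 6 ∷ []) true true (# 175) (# 78) (# 232) (# 334) ∷
  node (state true false false false 3 ∷ state true false false true 2 ∷ []) true true (# 170) (# 154) (# 294) (# 335) ∷
  node (state true true false false 7 ∷ state true true false true 6 ∷ []) false true (# 122) (# 38) (# 232) (# 329) ∷
  node (state false false false false 5 ∷ state true true false false 2 ∷ []) false true (# 336) (# 130) (# 87) (# 225) ∷
  node (state false true false true 5 ∷ state false true true true 6 ∷ []) false true (# 326) (# 337) (# 165) (# 101) ∷
  node (state false false false false 3 ∷ state true true false false 2 ∷ []) true true (# 129) (# 260) (# 206) (# 338) ∷
  node (state true true false false 2 ∷ state true true true true 1 ∷ []) true true (# 129) (# 260) (# 312) (# 338) ∷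
  node (state true false false false 2 ∷ state true true true false 2 ∷ []) true true (# 206) (# 117) (# 136) (# 93) ∷
  node (state true true false false 2 ∷ state true true false true 1 ∷ []) true true (# 311) (# 122) (# 310) (# 339) ∷
  node (state false true false true 3 ∷ state false true true false 3 ∷ []) false true (# 289) (# 340) (# 131) (# 59) ∷
  node (state false false false true 2 ∷ state true false true false 0 ∷ []) true true (# 341) (# 214) (# 170) (# 134) ∷
  node (state true true false false 5 ∷ state true true true true 6 ∷ []) true true (# 342) (# 209) (# 111) (# 343) ∷
  node (state true true false false 5 ∷ state true true false true 5 ∷ []) true true (# 37) (# 78) (# 292) (# 293) ∷
  node (state true true true false 1 ∷ state true true true true 0 ∷ []) true true (# 116) (# 226) (# 216) (# 9) ∷
  node (state true true false false 4 ∷ state true true false true 5 ∷ []) true true (# 37) (# 25) (# 292) (# 293) ∷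
  node (state true true false false 7 ∷ state true true false true 6 ∷ []) true true (# 175) (# 38) (# 232) (# 334) ∷
  node (state false false false true 2 ∷ state true false true false 1 ∷ []) true true (# 341) (# 244) (# 73) (# 175) ∷
  node (state true true false false 0 ∷ state true true false true 1 ∷ []) true true (# 216) (# 269) (# 195) (# 217) ∷
  node (state true true true false 0 ∷ state true true true true 1 ∷ []) true true (# 280) (# 218) (# 216) (# 9) ∷
  node (state true true false true 1 ∷ state true true true false 0 ∷ []) true true (# 344) (# 142) (# 281) (# 9) ∷
  node (state true true false false 6 ∷ state true true true true 7 ∷ []) false true (# 117) (# 209) (# 139) (# 246) ∷
  node (state false true false true 4 ∷ state false true true false 3 ∷ []) false true (# 289) (# 345) (# 242) (# 59) ∷
  node (state false true false true 6 ∷ state true true false false 5 ∷ []) false true (# 109) (# 209) (# 111) (# 48) ∷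
  node (state false false false false 5 ∷ state true true true false 2 ∷ []) true true (# 236) (# 190) (# 136) (# 93) ∷
  node (state false true false false 5 ∷ state false true false true 6 ∷ []) false true (# 109) (# 346) (# 134) (# 78) ∷
  node (state true true true false 6 ∷ state true true true true 7 ∷ []) false true (# 244) (# 347) (# 175) (# 185) ∷
  node (state false true false true 3 ∷ state false true true true 4 ∷ []) false true (# 210) (# 297) (# 63) (# 119) ∷
  node (state true false false false 1 ∷ state true false true false 1 ∷ []) true true (# 348) (# 40) (# 349) (# 62) ∷
  node (state false false false false 3 ∷ state false false true false 3 ∷ []) true true (# 321) (# 285) (# 320) (# 350) ∷
  node (state false false false false 5 ∷ state false true true true 3 ∷ []) false true (# 351) (# 161) (# 352) (# 126) ∷
  node (state false false false false 3 ∷ state false true true false 0 ∷ []) false true (# 261) (# 141) (# 280) (# 353) ∷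
  node (state false false false false 1 ∷ state false false true false 3 ∷ []) true true (# 257) (# 319) (# 354) (# 196) ∷
  node (state true true false true 2 ∷ state true true true true 4 ∷ []) false true (# 106) (# 64) (# 300) (# 205) ∷
  node (state false false false false 4 ∷ state false true true false 3 ∷ []) false true (# 289) (# 290) (# 87) (# 59) ∷
  node (state false true false true 7 ∷ state false true true true 7 ∷ []) false true (# 355) (# 327) (# 29) (# 207) ∷
  node (state true false true false 1 ∷ state true false true true 0 ∷ []) true true (# 186) (# 114) (# 73) (# 77) ∷
  node (state true true false false 7 ∷ state true true false true 7 ∷ []) false true (# 122) (# 80) (# 232) (# 329) ∷
  node (state false true false true 4 ∷ state true true false false 2 ∷ []) false true (# 171) (# 356) (# 242) (# 88) ∷
  node (state true true false false 6 ∷ state true true true true 4 ∷ []) false true (# 142) (# 44) (# 45) (# 143) ∷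
  node (state false false false false 4 ∷ state false true true true 4 ∷ []) false true (# 210) (# 357) (# 298) (# 119) ∷
  node (state false true false true 3 ∷ state true true false false 2 ∷ []) false true (# 57) (# 130) (# 131) (# 88) ∷
  node (state true true false false 7 ∷ state true true false true 7 ∷ []) true true (# 175) (# 80) (# 232) (# 334) ∷
  node (state true true false false 3 ∷ state true true false true 4 ∷ []) true true (# 240) (# 74) (# 301) (# 358) ∷
  node (state false false false false 4 ∷ state false false true true 2 ∷ []) false true (# 245) (# 314) (# 359) (# 135) ∷
  node (state false true false true 6 ∷ state false true true true 7 ∷ []) false true (# 326) (# 327) (# 29) (# 164) ∷
  node (state true true false false 5 ∷ state true true true true 4 ∷ []) true true (# 102) (# 44) (# 104) (# 105) ∷
  node (state true true false false 5 ∷ state true true false true 4 ∷ []) true true (# 37) (# 264) (# 292) (# 293) ∷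
  node (state false true false true 5 ∷ state false true true false 5 ∷ []) false true (# 155) (# 156) (# 104) (# 225) ∷
  node (state false false false true 2 ∷ state true false false false 0 ∷ []) true true (# 303) (# 241) (# 360) (# 111) ∷
  node (state true true false false 3 ∷ state true true true true 2 ∷ []) true true (# 213) (# 11) (# 131) (# 132) ∷
  node (state true true false false 6 ∷ state true true true true 7 ∷ []) true true (# 137) (# 209) (# 139) (# 140) ∷
  node (state false false false true 1 ∷ state true true true false 0 ∷ []) true true (# 116) (# 187) (# 281) (# 9) ∷
  node (state false true false true 6 ∷ state false true true false 5 ∷ []) false true (# 155) (# 361) (# 111) (# 225) ∷
  node (state false true false false 6 ∷ state false true false true 7 ∷ []) false true (# 179) (# 180) (# 175) (# 255) ∷
  node (state false true false true 7 ∷ state true true false true 6 ∷ []) false true (# 90) (# 362) (# 84) (# 265) ∷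
  node (state false false false false 2 ∷ state true false false false 0 ∷ []) true true (# 363) (# 55) (# 320) (# 21) ∷
  node (state true false false false 2 ∷ state true false true false 2 ∷ []) true true (# 320) (# 40) (# 349) (# 62) ∷
  node (state true true false true 4 ∷ state true true true true 4 ∷ []) true true (# 125) (# 119) (# 100) (# 167) ∷
  node (state false false false false 4 ∷ state false true true false 1 ∷ []) false true (# 261) (# 141) (# 116) (# 135) ∷
  node (state false false false false 3 ∷ state false false true false 4 ∷ []) true true (# 321) (# 285) (# 364) (# 350) ∷
  node (state true true false false 2 ∷ state true true true true 4 ∷ []) false true (# 158) (# 356) (# 242) (# 243) ∷
  node (state true false false false 1 ∷ state true false true false 0 ∷ []) true true (# 365) (# 67) (# 364) (# 69) ∷
  node (state false false false false 5 ∷ state false true true false 3 ∷ []) false true (# 366) (# 340) (# 87) (# 157) ∷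
  node (state false true false true 6 ∷ state true true true false 3 ∷ []) false true (# 189) (# 208) (# 367) (# 78) ∷
  node (state false true false true 4 ∷ state false true true true 6 ∷ []) false true (# 368) (# 337) (# 165) (# 108) ∷
  node (state true true false false 5 ∷ state true true false true 6 ∷ []) true true (# 134) (# 78) (# 369) (# 370) ∷
  node (state false false false true 2 ∷ state true false true false 2 ∷ []) true true (# 371) (# 244) (# 73) (# 175) ∷
  node (state true false false false 1 ∷ state true false true true 1 ∷ []) true true (# 303) (# 117) (# 372) (# 139) ∷
  node (state false true false true 7 ∷ state false true true false 6 ∷ []) false true (# 322) (# 259) (# 139) (# 243) ∷
  node (state false true true true 7 ∷ state true true true true 5 ∷ []) false true (# 187) (# 79) (# 316) (# 207) ∷
  node (state false false false false 2 ∷ state false false true false 1 ∷ []) true true (# 373) (# 60) (# 348) (# 62) ∷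
  node (state true false false false 2 ∷ state true false true false 1 ∷ []) true true (# 348) (# 40) (# 349) (# 62) ∷
  node (state false false false false 1 ∷ state true false false false 0 ∷ []) true true (# 363) (# 55) (# 354) (# 21) ∷
  node (state false false false false 4 ∷ state false true true true 1 ∷ []) false true (# 323) (# 285) (# 257) (# 169) ∷
  node (state true true true false 3 ∷ state true true true true 1 ∷ []) true true (# 310) (# 218) (# 311) (# 93) ∷
  node (state false false false false 3 ∷ state false true true false 3 ∷ []) false true (# 289) (# 290) (# 206) (# 59) ∷
  node (state true true false false 3 ∷ state true true false true 2 ∷ []) true true (# 113) (# 374) (# 112) (# 305) ∷
  node (state true true false false 6 ∷ state true true false true 7 ∷ []) true true (# 175) (# 255) (# 232) (# 334) ∷
  node (state false false false true 2 ∷ state true false false false 1 ∷ []) true true (# 303) (# 375) (# 376) (# 139) ∷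
  node (state true false false false 2 ∷ state true false true true 2 ∷ []) true true (# 309) (# 117) (# 372) (# 139) ∷
  node (state false false false false 2 ∷ state false false true false 2 ∷ []) true true (# 373) (# 60) (# 320) (# 62) ∷
  node (state true true true false 4 ∷ state true true true true 3 ∷ []) false true (# 176) (# 181) (# 233) (# 38) ∷
  node (state false true false false 3 ∷ state true true true true 3 ∷ []) false true (# 71) (# 181) (# 113) (# 25) ∷
  node (state true false false false 2 ∷ state true false true true 1 ∷ []) true true (# 309) (# 117) (# 372) (# 139) ∷
  []

nodeAt : Fin size → Node
nodeAt = lookup certificate

next : Fin size → Bool → Bool → Fin size
next i = successor (nodeAt i)

NodeValid : Fin size → Set
NodeValid i = BaseValid (nodeAt i) × (∀ α β → StepValid (nodeAt i) (nodeAt (next i α β)) α β)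

nodeValid? : ∀ i → Dec (NodeValid i)
nodeValid? i = baseValid? (nodeAt i) ×-dec ∀-bits? (λ α β → stepValid? (nodeAt i) (nodeAt (next i α β)) α β)

certificate-valid : ∀ i → NodeValid i
certificate-valid = toWitness {a? = Fin.all? nodeValid?} _

certificate-sound : ∀ i x y → NodeSound (nodeAt i) x y
certificate-sound i x y = ∷ᵇ-induction next (NodeSound ∘ nodeAt) base step y i x
  where
  base : ∀ i x → NodeSound (nodeAt i) x 0
  base i x = baseValid-sound (nodeAt i) x (proj₁ (certificate-valid i))
  step : ∀ i α β x y → NodeSound (nodeAt (next i α β)) x y → NodeSound (nodeAt i) (α ∷ᵇ x) (β ∷ᵇ y)
  step i α β = stepValid-sound (nodeAt i) (nodeAt (next i α β)) α β (proj₂ (certificate-valid i) α β)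

xor≡true⇒≢ : ∀ {u v} → u xor v ≡ true → u ≢ v
xor≡true⇒≢ {false} () refl
xor≡true⇒≢ {true}  () refl

separating-position : (a b : ℕ) → 1 ≤ a → a < b → ∃[ n ] (3 * n ≤ 5 * b × t n ≢ t (n + a) × t n ≢ t (n + b))
separating-position a b 1≤a a<b = fromRoot (certificate-sound (# 0) a b root-guard)
  where
  root-guard : Guard true false a b
  root-guard = subst (_≤ b) (+-comm 1 a) a<b , subst (1 ≤_) (sym (+-identityʳ a)) 1≤a
  fromRoot : Any (Realised a b) (state false false true true 3 ∷ []) →
             ∃[ n ] (3 * n ≤ 5 * b × t n ≢ t (n + a) × t n ≢ t (n + b))
  fromRoot (here (n , Δa , Δb , bound)) =
    n , +-cancelʳ-≤ 3 (3 * n) (5 * b) bound ,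
    xor≡true⇒≢ (subst (λ k → Δ k n ≡ true) (+-identityʳ a) Δa) ,
    xor≡true⇒≢ (subst (λ k → Δ k n ≡ true) (+-identityʳ b) Δb)

-- Sharpness of the bound

Covered : ℕ → ℕ → Set
Covered a b = ∀ i → 3 * i < 5 * b → t i ≡ t (i + a) ⊎ t i ≡ t (i + b)

covered-2-3 : Covered 2 3
covered-2-3 0 _ = inj₂ refl
covered-2-3 1 _ = inj₂ refl
covered-2-3 2 _ = inj₁ refl
covered-2-3 3 _ = inj₁ refl
covered-2-3 4 _ = inj₂ refl
covered-2-3 (suc (suc (suc (suc (suc i))))) 3i<15 = ⊥-elim (<⇒≱ 3i<15 (*-monoʳ-≤ 3 (m≤m+n 5 i)))

t-agree-∷ᵇ : ∀ r i a → t i ≡ t (i + a) → t (r ∷ᵇ i) ≡ t (r ∷ᵇ i + 2 * a)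
t-agree-∷ᵇ r i a e = begin
  t (r ∷ᵇ i)             ≡⟨ t-∷ᵇ r i ⟩
  t i xor r              ≡⟨ cong (_xor r) e ⟩
  t (i + a) xor r        ≡⟨ t-∷ᵇ r (i + a) ⟨
  t (r ∷ᵇ (i + a))       ≡⟨ cong t (shift (toℕ r) i a) ⟨
  t (r ∷ᵇ i + 2 * a)     ∎
  where
  open ≡-Reasoning
  shift : ∀ r i a → r + i * 2 + 2 * a ≡ r + (i + a) * 2
  shift = solve-∀

covered-double : ∀ a b → Covered a b → Covered (2 * a) (2 * b)
covered-double a b covered i 3i<10b =
  subst (λ n → t n ≡ t (n + 2 * a) ⊎ t n ≡ t (n + 2 * b)) (lowBit∷ᵇ⌊n/2⌋≡n i)
        (Sum.map (t-agree-∷ᵇ r i′ a) (t-agree-∷ᵇ r i′ b) (covered i′ 3i′<5b))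
  where
  open ≤-Reasoning
  r = lowBit i
  i′ = ⌊ i /2⌋
  3i′<5b : 3 * i′ < 5 * b
  3i′<5b = *-cancelʳ-< 2 (3 * i′) (5 * b) (begin-strict
    3 * i′ * 2      ≡⟨ *-assoc 3 i′ 2 ⟩
    3 * (i′ * 2)    ≤⟨ *-monoʳ-≤ 3 (m≤n+m (i′ * 2) (toℕ r)) ⟩
    3 * (r ∷ᵇ i′)   ≡⟨ cong (3 *_) (lowBit∷ᵇ⌊n/2⌋≡n i) ⟩
    3 * i           <⟨ 3i<10b ⟩
    5 * (2 * b)     ≡⟨ reorder b ⟩
    5 * b * 2       ∎)
    where reorder : ∀ b → 5 * (2 * b) ≡ 5 * b * 2
          reorder = solve-∀

covered-2^ : ∀ k → Covered (2 ^ suc k) (3 * 2 ^ k)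
covered-2^ zero    = covered-2-3
covered-2^ (suc k) = subst (Covered (2 ^ suc (suc k))) (reorder (2 ^ k)) (covered-double _ _ (covered-2^ k))
  where reorder : ∀ p → 2 * (3 * p) ≡ 3 * (2 * p)
        reorder = solve-∀

n<2^n : ∀ n → n < 2 ^ n
n<2^n zero    = z<s
n<2^n (suc n) = ≤-<-trans (n<2^n n) (m<m+n (2 ^ n) (≤-trans (m^n>0 2 n) (m≤m+n (2 ^ n) 0)))

bound-is-sharp : (m : ℕ) → ∃[ a ] ∃[ b ] (1 ≤ a × a < b × m < b × Covered a b)
bound-is-sharp m = 2 ^ suc m , 3 * 2 ^ m , m^n>0 2 (suc m) , *-monoˡ-< (2 ^ m) {{m^n≢0 2 m}} (n<1+n 2) ,
                   <-≤-trans (n<2^n m) (m≤n*m (2 ^ m) 3) , covered-2^ m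

theorem12 :
    ((a b : ℕ) → 1 ≤ a → a < b →
      ∃[ n ] (3 * n ≤ 5 * b × t n ≢ t (n + a) × t n ≢ t (n + b)))
    ×
    ((m : ℕ) → ∃[ a ] ∃[ b ] (1 ≤ a × a < b × m < b ×
      ((i : ℕ) → 3 * i < 5 * b → (t i ≡ t (i + a) ⊎ t i ≡ t (i + b)))))
theorem12 = separating-position , bound-is-sharp
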